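{- For every finite string $W$ in the letters $A,B,X$ the following hold, where $|\cdot|$ of a finite string denotes the value of the corresponding open sentence in the tight puzzle: (1) $|WAAA|+t|W|=0$; (2) $|WXAA|-t|W|=0$; (3) $|WXXA|+t|W|=0$; (4) $|WAXA|-t|WA|-2t|W|=0$; (5) $|WABA|+t|WA|+t|W|=0$.
   Context: Tight puzzle: words with (coefficient, weight) $X$ $(1,0)$; $XA$ $(1,1)$; $XAA$ $(1,1)$; $AXA$ $(2,1)$; $AAA$ $(-1,1)$; $BA$ $(-1,1)$; $ABA$ $(-1,1)$; $XXA$ $(-1,1)$. A parsing is a decomposition of a string into consecutive words from this list, in which the word $X$ is never immediately followed by the word $XA$ nor by the word $BA$. For a finite string $W$, the open sentence $W$ is the bi-infinite string obtained by padding $W$ on both sides with infinitely many $X$'s (up to shift); its parsings decompose the whole bi-infinite string. Coefficient of a parsing = product of coefficients of its words, weight = sum of weights; $c(S,w)$ = sum of coefficients of weight-$w$ parsings; $|S|=\sum_{w\ge0}c(S,w)t^w$. -}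

module Defs where

open import Data.Bool using (Bool; true; false; _∧_; if_then_else_)
open import Data.Nat using (ℕ; zero; suc; _≡ᵇ_)
open import Data.Integer using (ℤ; +_; -[1+_]; _+_; _*_; _-_)
open import Data.List using (List; []; _∷_; _++_; map; concat; concatMap; foldr; length; upTo)

data Letter : Set where
  A B X : Letter

_==ᴸ_ : Letter → Letter → Bool
A ==ᴸ A = true
B ==ᴸ B = true
X ==ᴸ X = true
_ ==ᴸ _ = false

_==ˢ_ : List Letter → List Letter → Bool
[] ==ˢ [] = true
(a ∷ u) ==ˢ (b ∷ v) = (a ==ᴸ b) ∧ (u ==ˢ v)
_ ==ˢ _ = false

data Word : Set where
  wX wXA wXAA wAXA wAAA wBA wABA wXXA : Word

allWords : List Word
allWords = wX ∷ wXA ∷ wXAA ∷ wAXA ∷ wAAA ∷ wBA ∷ wABA ∷ wXXA ∷ []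

spell : Word → List Letter
spell wX   = X ∷ []
spell wXA  = X ∷ A ∷ []
spell wXAA = X ∷ A ∷ A ∷ []
spell wAXA = A ∷ X ∷ A ∷ []
spell wAAA = A ∷ A ∷ A ∷ []
spell wBA  = B ∷ A ∷ []
spell wABA = A ∷ B ∷ A ∷ []
spell wXXA = X ∷ X ∷ A ∷ []

coef : Word → ℤ
coef wX   = + 1
coef wXA  = + 1
coef wXAA = + 1
coef wAXA = + 2
coef wAAA = -[1+ 0 ]
coef wBA  = -[1+ 0 ]
coef wABA = -[1+ 0 ]
coef wXXA = -[1+ 0 ]

weight : Word → ℕ
weight wX = 0
weight _  = 1

forbidden : Word → Word → Bool
forbidden wX wXA = true
forbidden wX wBA = true
forbidden _  _   = false

adjOK : List Word → Bool
adjOK [] = true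
adjOK (u ∷ []) = true
adjOK (u ∷ v ∷ ws) = (if forbidden u v then false else true) ∧ adjOK (v ∷ ws)

isParsing : List Letter → List Word → Bool
isParsing s ws = (concat (map spell ws) ==ˢ s) ∧ adjOK ws

coefP : List Word → ℤ
coefP = foldr (λ u r → coef u * r) (+ 1)

weightP : List Word → ℕ
weightP = foldr (λ u r → weight u Data.Nat.+ r) 0

listsOfLength : ℕ → List (List Word)
listsOfLength zero = [] ∷ []
listsOfLength (suc n) = concatMap (λ u → map (u ∷_) (listsOfLength n)) allWords

-- every parsing of s has at most (length s) words (each word is nonempty)
candidates : List Letter → List (List Word)
candidates s = concatMap listsOfLength (upTo (suc (length s)))

-- Open sentence of W: ...XXX W XXX...  Every word other than X contains an
-- A or a B and ends in A, so non-X words never enter the right padding and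
-- reach at most 2 letters into the left padding; hence parsings of the open
-- sentence W correspond bijectively to parsings of the finite string XXXW
-- (extended by the word X on both sides), with the same coefficient/weight.
pad : List Letter → List Letter
pad W = X ∷ X ∷ X ∷ W

c : List Letter → ℕ → ℤ
c W w = foldr (λ p r → (if isParsing (pad W) p ∧ (weightP p ≡ᵇ w) then coefP p else + 0) + r)
              (+ 0) (candidates (pad W))

-- |W| as a power series in t, represented by its coefficient sequence
val : List Letter → ℕ → ℤ
val W = c W

t· : (ℕ → ℤ) → ℕ → ℤ
t· p zero = + 0
t· p (suc w) = p w

-- Sort the parsings of the padded string XXX W q by their last word. The last
-- word must spell a suffix of q, and removing it leaves a parsing of XXX W
-- (or of XXX W A) of weight one less, whose coefficient gets multiplied by the
-- coefficient of that word. For q = AAA and q = XAA only the word q itself fits.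
-- For q = XXA the word XA would also fit, but the preceding word would then end
-- in X, i.e. be the word X, which may not precede XA; so again only q fits. For
-- q = AXA and q = ABA the words XA and BA fit as well; the word before them ends
-- in A, so the adjacency rule never intervenes. Reading off coefficients gives
-- the five relations; in weight 0 all sides vanish because the last word of a
-- string ending in A has weight 1.
module Submission where

open import Defs
open import Data.Bool using (Bool; true; false; _∧_; if_then_else_)
open import Data.Bool.Properties using (∧-identityʳ; ∧-zeroʳ; ∧-assoc; ⇔→≡)
open import Data.Nat as ℕ using (ℕ; zero; suc; _≡ᵇ_; _≤_; _<_; s≤s; z≤n)
import Data.Nat.Properties as ℕP
import Data.Nat.Tactic.RingSolver as ℕSolver
open import Data.Integer using (ℤ; +_; -[1+_]; _+_; _*_; _-_)
import Data.Integer.Properties as ℤP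
open import Data.Integer.Tactic.RingSolver using (solve-∀)
open import Data.List
  using (List; []; _∷_; _++_; _∷ʳ_; [_]; foldr; map; concat; concatMap; length; upTo; reverse; initLast; _∷ʳ′_)
open import Data.List.Properties
  using ( map-++; concat-++; ++-identityʳ; ++-assoc; reverse-++; reverse-injective
        ; length-++; length-++-sucʳ; length-++-≤ˡ; upTo-∷ʳ; map-upTo)
open import Data.Product using (_×_; _,_)
open import Data.Sum using (inj₁; inj₂)
open import Function using (_∘_; mk⇔)
open import Data.Empty using (⊥-elim)
open import Relation.Binary.PropositionalEquality
  using (_≡_; refl; sym; trans; cong; cong₂; subst; module ≡-Reasoning)

open ≡-Reasoning

sumOf : {B : Set} → (B → ℤ) → List B → ℤ
sumOf f = foldr (λ x r → f x + r) (+ 0)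

module _ {B : Set} where

  sumOf-++ : (f : B → ℤ) (xs ys : List B) → sumOf f (xs ++ ys) ≡ sumOf f xs + sumOf f ys
  sumOf-++ f []       ys = sym (ℤP.+-identityˡ _)
  sumOf-++ f (x ∷ xs) ys = trans (cong (_+_ (f x)) (sumOf-++ f xs ys)) (sym (ℤP.+-assoc (f x) _ _))

  sumOf-map : {C : Set} (f : B → ℤ) (g : C → B) (xs : List C) → sumOf f (map g xs) ≡ sumOf (f ∘ g) xs
  sumOf-map f g []       = refl
  sumOf-map f g (x ∷ xs) = cong (_+_ (f (g x))) (sumOf-map f g xs)

  sumOf-concatMap : {C : Set} (f : B → ℤ) (g : C → List B) (xs : List C) →
                    sumOf f (concatMap g xs) ≡ sumOf (sumOf f ∘ g) xs
  sumOf-concatMap f g []       = refl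
  sumOf-concatMap f g (x ∷ xs) = trans (sumOf-++ f (g x) _) (cong (_+_ (sumOf f (g x))) (sumOf-concatMap f g xs))

  sumOf-cong : {f g : B → ℤ} → (∀ x → f x ≡ g x) → (xs : List B) → sumOf f xs ≡ sumOf g xs
  sumOf-cong f≗g []       = refl
  sumOf-cong f≗g (x ∷ xs) = cong₂ _+_ (f≗g x) (sumOf-cong f≗g xs)

  sumOf-zero : {f : B → ℤ} → (∀ x → f x ≡ + 0) → (xs : List B) → sumOf f xs ≡ + 0
  sumOf-zero f≗0 []       = refl
  sumOf-zero f≗0 (x ∷ xs) = cong₂ _+_ (f≗0 x) (sumOf-zero f≗0 xs)

  sumOf-+ : (f g : B → ℤ) (xs : List B) → sumOf (λ x → f x + g x) xs ≡ sumOf f xs + sumOf g xs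
  sumOf-+ f g []       = refl
  sumOf-+ f g (x ∷ xs) = trans (cong (_+_ (f x + g x)) (sumOf-+ f g xs)) (shuffle (f x) (g x) _ _)
    where
    shuffle : ∀ a b c d → a + b + (c + d) ≡ a + c + (b + d)
    shuffle = solve-∀

  sumOf-* : (k : ℤ) (f : B → ℤ) (xs : List B) → sumOf (λ x → k * f x) xs ≡ k * sumOf f xs
  sumOf-* k f []       = sym (ℤP.*-zeroʳ k)
  sumOf-* k f (x ∷ xs) = trans (cong (_+_ (k * f x)) (sumOf-* k f xs)) (sym (ℤP.*-distribˡ-+ k (f x) _))

sumOf-upTo-suc : (h : ℕ → ℤ) (N : ℕ) → sumOf h (upTo (suc N)) ≡ h 0 + sumOf (h ∘ suc) (upTo N)
sumOf-upTo-suc h N = cong (_+_ (h 0)) (trans (cong (sumOf h) (sym (map-upTo suc N))) (sumOf-map h suc (upTo N)))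

sumOf-upTo-∷ʳ : (h : ℕ → ℤ) (N : ℕ) → sumOf h (upTo (suc N)) ≡ sumOf h (upTo N) + h N
sumOf-upTo-∷ʳ h N = begin
  sumOf h (upTo (suc N))           ≡⟨ cong (sumOf h) (sym (upTo-∷ʳ N)) ⟩
  sumOf h (upTo N ++ [ N ])        ≡⟨ sumOf-++ h (upTo N) [ N ] ⟩
  sumOf h (upTo N) + (h N + + 0)   ≡⟨ cong (_+_ (sumOf h (upTo N))) (ℤP.+-identityʳ (h N)) ⟩
  sumOf h (upTo N) + h N           ∎

sumOf-upTo-vanishing : (h : ℕ → ℤ) {k : ℕ} (N : ℕ) → (∀ n → k ≤ n → h n ≡ + 0) → k ≤ N →
                       sumOf h (upTo N) ≡ sumOf h (upTo k)
sumOf-upTo-vanishing h zero    h≗0 z≤n = refl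
sumOf-upTo-vanishing h {k} (suc N) h≗0 k≤1+N with ℕP.m≤n⇒m<n∨m≡n k≤1+N
... | inj₂ refl        = refl
... | inj₁ (s≤s k≤N) = begin
  sumOf h (upTo (suc N))   ≡⟨ sumOf-upTo-∷ʳ h N ⟩
  sumOf h (upTo N) + h N   ≡⟨ cong₂ _+_ (sumOf-upTo-vanishing h N h≗0 k≤N) (h≗0 N k≤N) ⟩
  sumOf h (upTo k) + + 0   ≡⟨ ℤP.+-identityʳ _ ⟩
  sumOf h (upTo k)         ∎

sumLength : (List Word → ℤ) → ℕ → ℤ
sumLength f n = sumOf f (listsOfLength n)

sumLength-∷ : (f : List Word → ℤ) (n : ℕ) →
              sumLength f (suc n) ≡ sumOf (λ u → sumLength (f ∘ (u ∷_)) n) allWords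
sumLength-∷ f n = trans (sumOf-concatMap f (λ u → map (u ∷_) (listsOfLength n)) allWords)
                        (sumOf-cong (λ u → sumOf-map f (u ∷_) (listsOfLength n)) allWords)

sumLength-∷ʳ : (f : List Word → ℤ) (n : ℕ) →
               sumLength f (suc n) ≡ sumLength (λ ws → sumOf (λ u → f (ws ∷ʳ u)) allWords) n
sumLength-∷ʳ f zero = begin
  sumLength f 1                                ≡⟨ sumLength-∷ f 0 ⟩
  sumOf (λ u → f [ u ] + + 0) allWords         ≡⟨ sumOf-cong (λ u → ℤP.+-identityʳ (f [ u ])) allWords ⟩
  sumOf (λ u → f [ u ]) allWords               ≡⟨ ℤP.+-identityʳ _ ⟨
  sumOf (λ u → f [ u ]) allWords + + 0         ∎
sumLength-∷ʳ f (suc n) = begin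
  sumLength f (suc (suc n))
    ≡⟨ sumLength-∷ f (suc n) ⟩
  sumOf (λ u → sumLength (f ∘ (u ∷_)) (suc n)) allWords
    ≡⟨ sumOf-cong (λ u → sumLength-∷ʳ (f ∘ (u ∷_)) n) allWords ⟩
  sumOf (λ u → sumLength (λ ws → sumOf (λ v → f (u ∷ ws ∷ʳ v)) allWords) n) allWords
    ≡⟨ sumLength-∷ (λ ws → sumOf (λ v → f (ws ∷ʳ v)) allWords) n ⟨
  sumLength (λ ws → sumOf (λ v → f (ws ∷ʳ v)) allWords) (suc n)
    ∎

sumLength-vanishing : (f : List Word → ℤ) (n : ℕ) → (∀ ws → length ws ≡ n → f ws ≡ + 0) →
                      sumLength f n ≡ + 0
sumLength-vanishing f zero    f≗0 = cong (_+ + 0) (f≗0 [] refl)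
sumLength-vanishing f (suc n) f≗0 = trans (sumLength-∷ f n)
  (sumOf-zero (λ u → sumLength-vanishing (f ∘ (u ∷_)) n (λ ws len → f≗0 (u ∷ ws) (cong suc len))) allWords)

sumShorter : (List Word → ℤ) → ℕ → ℤ
sumShorter f N = sumOf (sumLength f) (upTo N)

sumShorter-+ : (f g : List Word → ℤ) (N : ℕ) → sumShorter (λ ws → f ws + g ws) N ≡ sumShorter f N + sumShorter g N
sumShorter-+ f g N = trans (sumOf-cong (λ n → sumOf-+ f g (listsOfLength n)) (upTo N))
                           (sumOf-+ (sumLength f) (sumLength g) (upTo N))

sumShorter-* : (k : ℤ) (f : List Word → ℤ) (N : ℕ) → sumShorter (λ ws → k * f ws) N ≡ k * sumShorter f N
sumShorter-* k f N = trans (sumOf-cong (λ n → sumOf-* k f (listsOfLength n)) (upTo N))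
                           (sumOf-* k (sumLength f) (upTo N))

length-<-++ : {B : Set} (xs : List B) {y : B} {ys : List B} → length xs < length (xs ++ y ∷ ys)
length-<-++ xs {y} {ys} = subst (length xs <_) (sym (length-++-sucʳ xs y ys)) (s≤s (length-++-≤ˡ xs))

length-∷ʳ-<-++ : {B : Set} (xs : List B) (y : B) {z : B} {zs : List B} →
                 length (xs ∷ʳ y) < length (xs ++ y ∷ z ∷ zs)
length-∷ʳ-<-++ xs y {z} {zs} =
  subst (λ s → length (xs ∷ʳ y) < length s) (++-assoc xs [ y ] (z ∷ zs)) (length-<-++ (xs ∷ʳ y))

∧-true-left : ∀ {a b} → (a ∧ b) ≡ true → a ≡ true
∧-true-left {true} _ = refl

if-guarded : {B : Set} (b : Bool) {o : Bool} {x y : B} → (b ≡ true → o ≡ true) →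
             (if b then (if o then x else y) else y) ≡ (if b then x else y)
if-guarded false guard = refl
if-guarded true  guard rewrite guard refl = refl

if-blocked : {B : Set} (b : Bool) {o : Bool} {x y : B} → (b ≡ true → o ≡ false) →
             (if b then (if o then x else y) else y) ≡ y
if-blocked false block = refl
if-blocked true  block rewrite block refl = refl

if-∧-guard : ∀ m a o b (x k : ℤ) →
             (if (m ∧ (a ∧ o)) ∧ b then x * k else + 0) ≡ k * (if (m ∧ a) ∧ b then (if o then x else + 0) else + 0)
if-∧-guard false a     o     b     x k = sym (ℤP.*-zeroʳ k)
if-∧-guard true  false o     b     x k = sym (ℤP.*-zeroʳ k)
if-∧-guard true  true  true  true  x k = ℤP.*-comm x k
if-∧-guard true  true  true  false x k = sym (ℤP.*-zeroʳ k)
if-∧-guard true  true  false true  x k = sym (ℤP.*-zeroʳ k)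
if-∧-guard true  true  false false x k = sym (ℤP.*-zeroʳ k)

==ᴸ-refl : ∀ a → (a ==ᴸ a) ≡ true
==ᴸ-refl A = refl
==ᴸ-refl B = refl
==ᴸ-refl X = refl

==ᴸ-sound : ∀ a b → (a ==ᴸ b) ≡ true → a ≡ b
==ᴸ-sound A A _ = refl
==ᴸ-sound B B _ = refl
==ᴸ-sound X X _ = refl
==ᴸ-sound A B ()
==ᴸ-sound A X ()
==ᴸ-sound B A ()
==ᴸ-sound B X ()
==ᴸ-sound X A ()
==ᴸ-sound X B ()

==ˢ-refl : ∀ xs → (xs ==ˢ xs) ≡ true
==ˢ-refl []       = refl
==ˢ-refl (a ∷ xs) = trans (cong (_∧ (xs ==ˢ xs)) (==ᴸ-refl a)) (==ˢ-refl xs)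

==ˢ-sound : ∀ xs ys → (xs ==ˢ ys) ≡ true → xs ≡ ys
==ˢ-sound []       []       _ = refl
==ˢ-sound (a ∷ xs) (b ∷ ys) eq with a ==ᴸ b in a≡b
... | true = cong₂ _∷_ (==ᴸ-sound a b a≡b) (==ˢ-sound xs ys eq)

==ˢ-complete : ∀ {xs ys} → xs ≡ ys → (xs ==ˢ ys) ≡ true
==ˢ-complete {xs} refl = ==ˢ-refl xs

==ˢ-reverse : ∀ xs ys → (xs ==ˢ ys) ≡ (reverse xs ==ˢ reverse ys)
==ˢ-reverse xs ys = ⇔→≡ (mk⇔
  (λ eq → ==ˢ-complete {reverse xs} (cong reverse (==ˢ-sound xs ys eq)))
  (λ eq → ==ˢ-complete {xs} (reverse-injective (==ˢ-sound (reverse xs) (reverse ys) eq))))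

==ˢ-++ˡ : ∀ xs ys zs → ((xs ++ ys) ==ˢ (xs ++ zs)) ≡ (ys ==ˢ zs)
==ˢ-++ˡ []       ys zs = refl
==ˢ-++ˡ (a ∷ xs) ys zs = trans (cong (_∧ ((xs ++ ys) ==ˢ (xs ++ zs))) (==ᴸ-refl a)) (==ˢ-++ˡ xs ys zs)

spelling : List Word → List Letter
spelling ws = concat (map spell ws)

term : List Letter → ℕ → List Word → ℤ
term s w ws = if isParsing s ws ∧ (weightP ws ≡ᵇ w) then coefP ws else + 0

admits : Word → Word → Bool
admits v u = if forbidden v u then false else true

lastAdmits : List Word → Word → Bool
lastAdmits []           u = true
lastAdmits (v ∷ [])     u = admits v u
lastAdmits (_ ∷ v ∷ vs) u = lastAdmits (v ∷ vs) u

spelling-∷ʳ : ∀ ws u → spelling (ws ∷ʳ u) ≡ spelling ws ++ spell u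
spelling-∷ʳ ws u = begin
  concat (map spell (ws ∷ʳ u))                 ≡⟨ cong concat (map-++ spell ws [ u ]) ⟩
  concat (map spell ws ++ [ spell u ])         ≡⟨ concat-++ (map spell ws) [ spell u ] ⟨
  spelling ws ++ (spell u ++ [])               ≡⟨ cong (spelling ws ++_) (++-identityʳ (spell u)) ⟩
  spelling ws ++ spell u                       ∎

reverse-spelling-∷ʳ : ∀ ws u → reverse (spelling (ws ∷ʳ u)) ≡ reverse (spell u) ++ reverse (spelling ws)
reverse-spelling-∷ʳ ws u = trans (cong reverse (spelling-∷ʳ ws u)) (reverse-++ (spelling ws) (spell u))

adjOK-∷ʳ : ∀ ws u → adjOK (ws ∷ʳ u) ≡ adjOK ws ∧ lastAdmits ws u
adjOK-∷ʳ []           u = refl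
adjOK-∷ʳ (v ∷ [])     u = ∧-identityʳ (admits v u)
adjOK-∷ʳ (v ∷ v′ ∷ vs) u = trans (cong (admits v v′ ∧_) (adjOK-∷ʳ (v′ ∷ vs) u))
                                (sym (∧-assoc (admits v v′) (adjOK (v′ ∷ vs)) _))

lastAdmits-∷ʳ : ∀ ws v u → lastAdmits (ws ∷ʳ v) u ≡ admits v u
lastAdmits-∷ʳ []           v u = refl
lastAdmits-∷ʳ (_ ∷ [])     v u = refl
lastAdmits-∷ʳ (_ ∷ v′ ∷ vs) v u = lastAdmits-∷ʳ (v′ ∷ vs) v u

weightP-∷ʳ : ∀ ws u → weightP (ws ∷ʳ u) ≡ weight u ℕ.+ weightP ws
weightP-∷ʳ []       u = refl
weightP-∷ʳ (v ∷ ws) u =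
  trans (cong (weight v ℕ.+_) (weightP-∷ʳ ws u)) (left-comm (weight v) (weight u) (weightP ws))
  where
  left-comm : ∀ a b d → a ℕ.+ (b ℕ.+ d) ≡ b ℕ.+ (a ℕ.+ d)
  left-comm = ℕSolver.solve-∀

coefP-∷ʳ : ∀ ws u → coefP (ws ∷ʳ u) ≡ coefP ws * coef u
coefP-∷ʳ []       u = trans (ℤP.*-identityʳ (coef u)) (sym (ℤP.*-identityˡ (coef u)))
coefP-∷ʳ (v ∷ ws) u = trans (cong (coef v *_) (coefP-∷ʳ ws u)) (sym (ℤP.*-assoc (coef v) (coefP ws) (coef u)))

1≤length-spell : ∀ u → 1 ≤ length (spell u)
1≤length-spell wX   = s≤s z≤n
1≤length-spell wXA  = s≤s z≤n
1≤length-spell wXAA = s≤s z≤n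
1≤length-spell wAXA = s≤s z≤n
1≤length-spell wAAA = s≤s z≤n
1≤length-spell wBA  = s≤s z≤n
1≤length-spell wABA = s≤s z≤n
1≤length-spell wXXA = s≤s z≤n

length≤length-spelling : ∀ ws → length ws ≤ length (spelling ws)
length≤length-spelling []       = z≤n
length≤length-spelling (u ∷ ws) =
  ℕP.≤-trans (ℕP.+-mono-≤ (1≤length-spell u) (length≤length-spelling ws))
             (ℕP.≤-reflexive (sym (length-++ (spell u))))

term-long : ∀ s w ws → length s < length ws → term s w ws ≡ + 0
term-long s w ws s<ws with isParsing s ws in parse
... | false = refl
... | true  = ⊥-elim (ℕP.<⇒≱ s<ws (subst (λ t → length ws ≤ length t) spelling≡s (length≤length-spelling ws)))
  where
  spelling≡s : spelling ws ≡ s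
  spelling≡s = ==ˢ-sound (spelling ws) s (∧-true-left parse)

-- Strings are compared through their reversals, so that the letters of the last
-- word form a prefix and matching them against a concrete suffix computes. The
-- adjacency test of lastWordTerm sits inside the match, so words that do not
-- fit the suffix contribute 0 by computation.
revTerm : List Letter → ℕ → List Word → ℤ
revTerm r w ws = if ((reverse (spelling ws) ==ˢ r) ∧ adjOK ws) ∧ (weightP ws ≡ᵇ w) then coefP ws else + 0

lastWordTerm : List Letter → ℕ → List Word → Word → ℤ
lastWordTerm r w ws u =
  coef u * (if (((reverse (spell u) ++ reverse (spelling ws)) ==ˢ r) ∧ adjOK ws) ∧ (weight u ℕ.+ weightP ws ≡ᵇ w)
            then (if lastAdmits ws u then coefP ws else + 0) else + 0)

lastWordSum : List Letter → ℕ → List Word → ℤ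
lastWordSum s w ws = sumOf (λ u → term s w (ws ∷ʳ u)) allWords

term-reverse : ∀ s w ws → term s w ws ≡ revTerm (reverse s) w ws
term-reverse s w ws =
  cong (λ b → if (b ∧ adjOK ws) ∧ (weightP ws ≡ᵇ w) then coefP ws else + 0) (==ˢ-reverse (spelling ws) s)

term-reverse-∷ʳ : ∀ p a w ws → term (p ∷ʳ a) w ws ≡ revTerm (a ∷ reverse p) w ws
term-reverse-∷ʳ p a w ws = trans (term-reverse (p ∷ʳ a) w ws) (cong (λ r → revTerm r w ws) (reverse-++ p [ a ]))

term-∷ʳ : ∀ s w ws u → term s w (ws ∷ʳ u) ≡ lastWordTerm (reverse s) w ws u
term-∷ʳ s w ws u
  rewrite ==ˢ-reverse (spelling (ws ∷ʳ u)) s | reverse-spelling-∷ʳ ws u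
        | adjOK-∷ʳ ws u | weightP-∷ʳ ws u | coefP-∷ʳ ws u
  = if-∧-guard ((reverse (spell u) ++ reverse (spelling ws)) ==ˢ reverse s) (adjOK ws) (lastAdmits ws u)
               (weight u ℕ.+ weightP ws ≡ᵇ w) (coefP ws) (coef u)

lastWordSum-++ : ∀ p q w ws →
                 lastWordSum (p ++ q) w ws ≡ sumOf (lastWordTerm (reverse q ++ reverse p) w ws) allWords
lastWordSum-++ p q w ws = trans (sumOf-cong (term-∷ʳ (p ++ q) w ws) allWords)
                                (cong (λ r → sumOf (lastWordTerm r w ws) allWords) (reverse-++ p q))

c-sumShorter : ∀ W w → c W w ≡ sumShorter (term (pad W) w) (suc (length (pad W)))
c-sumShorter W w = sumOf-concatMap (term (pad W) w) listsOfLength (upTo (suc (length (pad W))))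

c-sumShorter-≥ : ∀ W w N → length (pad W) < N → c W w ≡ sumShorter (term (pad W) w) N
c-sumShorter-≥ W w N len<N = trans (c-sumShorter W w) (sym (sumOf-upTo-vanishing _ N long≗0 len<N))
  where
  long≗0 : ∀ n → length (pad W) < n → sumLength (term (pad W) w) n ≡ + 0
  long≗0 n len<n =
    sumLength-vanishing _ n (λ ws len≡n → term-long (pad W) w ws (subst (length (pad W) <_) (sym len≡n) len<n))

c-lastWordSum : ∀ W w → c W w ≡ sumShorter (lastWordSum (pad W) w) (length (pad W))
c-lastWordSum W w = begin
  c W w                                                      ≡⟨ c-sumShorter W w ⟩
  sumShorter (term (pad W) w) (suc L)                        ≡⟨ sumOf-upTo-suc (sumLength (term (pad W) w)) L ⟩
  + 0 + sumOf (sumLength (term (pad W) w) ∘ suc) (upTo L)    ≡⟨ ℤP.+-identityˡ _ ⟩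
  sumOf (sumLength (term (pad W) w) ∘ suc) (upTo L)          ≡⟨ sumOf-cong (sumLength-∷ʳ (term (pad W) w)) (upTo L) ⟩
  sumShorter (lastWordSum (pad W) w) L                       ∎
  where
  L : ℕ
  L = length (pad W)

c-by-lastWordSum : ∀ W q w (g : List Word → ℤ) → (∀ ws → lastWordSum (pad W ++ q) w ws ≡ g ws) →
                   c (W ++ q) w ≡ sumShorter g (length (pad W ++ q))
c-by-lastWordSum W q w g step =
  trans (c-lastWordSum (W ++ q) w)
        (sumOf-cong (λ n → sumOf-cong step (listsOfLength n)) (upTo (length (pad W ++ q))))

c-vanishing : ∀ W q w → (∀ ws → lastWordSum (pad W ++ q) w ws ≡ + 0) → c (W ++ q) w ≡ + 0
c-vanishing W q w step =
  trans (c-by-lastWordSum W q w (λ _ → + 0) step)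
        (sumOf-zero (λ n → sumOf-zero (λ _ → refl) (listsOfLength n)) (upTo (length (pad W ++ q))))

c-recurrence₁ : ∀ W q {w w′} (k : ℤ) V → length (pad V) < length (pad W ++ q) →
                (∀ ws → lastWordSum (pad W ++ q) w ws ≡ k * term (pad V) w′ ws) →
                c (W ++ q) w ≡ k * c V w′
c-recurrence₁ W q {w} {w′} k V V<Wq step = begin
  c (W ++ q) w                                          ≡⟨ c-by-lastWordSum W q w _ step ⟩
  sumShorter (λ ws → k * term (pad V) w′ ws) L          ≡⟨ sumShorter-* k _ L ⟩
  k * sumShorter (term (pad V) w′) L                    ≡⟨ cong (k *_) (c-sumShorter-≥ V w′ L V<Wq) ⟨
  k * c V w′                                            ∎
  where
  L : ℕ
  L = length (pad W ++ q)

c-recurrence₂ : ∀ W q {w w′} (k l : ℤ) V₁ V₂ →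
                length (pad V₁) < length (pad W ++ q) → length (pad V₂) < length (pad W ++ q) →
                (∀ ws → lastWordSum (pad W ++ q) w ws ≡ k * term (pad V₁) w′ ws + l * term (pad V₂) w′ ws) →
                c (W ++ q) w ≡ k * c V₁ w′ + l * c V₂ w′
c-recurrence₂ W q {w} {w′} k l V₁ V₂ V₁<Wq V₂<Wq step = begin
  c (W ++ q) w
    ≡⟨ c-by-lastWordSum W q w _ step ⟩
  sumShorter (λ ws → f₁ ws + f₂ ws) L
    ≡⟨ sumShorter-+ f₁ f₂ L ⟩
  sumShorter f₁ L + sumShorter f₂ L
    ≡⟨ cong₂ _+_ (sumShorter-* k _ L) (sumShorter-* l _ L) ⟩
  k * sumShorter (term (pad V₁) w′) L + l * sumShorter (term (pad V₂) w′) L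
    ≡⟨ cong₂ (λ a b → k * a + l * b) (c-sumShorter-≥ V₁ w′ L V₁<Wq) (c-sumShorter-≥ V₂ w′ L V₂<Wq) ⟨
  k * c V₁ w′ + l * c V₂ w′
    ∎
  where
  L : ℕ
  L = length (pad W ++ q)
  f₁ f₂ : List Word → ℤ
  f₁ ws = k * term (pad V₁) w′ ws
  f₂ ws = l * term (pad V₂) w′ ws

admits-unforbidden : ∀ v u → forbidden wX u ≡ false → admits v u ≡ true
admits-unforbidden wX   u free rewrite free = refl
admits-unforbidden wXA  u free = refl
admits-unforbidden wXAA u free = refl
admits-unforbidden wAXA u free = refl
admits-unforbidden wAAA u free = refl
admits-unforbidden wBA  u free = refl
admits-unforbidden wABA u free = refl
admits-unforbidden wXXA u free = refl

lastAdmits-unforbidden : ∀ ws u → forbidden wX u ≡ false → lastAdmits ws u ≡ true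
lastAdmits-unforbidden []           u free = refl
lastAdmits-unforbidden (v ∷ [])     u free = admits-unforbidden v u free
lastAdmits-unforbidden (_ ∷ v ∷ vs) u free = lastAdmits-unforbidden (v ∷ vs) u free

admits-after-A : ∀ v u {rest r} → reverse (spell v) ++ rest ≡ A ∷ r → admits v u ≡ true
admits-after-A wX   u ()
admits-after-A wXA  u _ = refl
admits-after-A wXAA u _ = refl
admits-after-A wAXA u _ = refl
admits-after-A wAAA u _ = refl
admits-after-A wBA  u _ = refl
admits-after-A wABA u _ = refl
admits-after-A wXXA u _ = refl

admits-XA-after-X : ∀ v {rest r} → reverse (spell v) ++ rest ≡ X ∷ r → admits v wXA ≡ false
admits-XA-after-X wX   _ = refl
admits-XA-after-X wXA  ()
admits-XA-after-X wXAA ()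
admits-XA-after-X wAXA ()
admits-XA-after-X wAAA ()
admits-XA-after-X wBA  ()
admits-XA-after-X wABA ()
admits-XA-after-X wXXA ()

lastAdmits-lastWord : ∀ ws u {a r} {b : Bool} → (∀ v {rest} → reverse (spell v) ++ rest ≡ a ∷ r → admits v u ≡ b) →
                      reverse (spelling ws) ≡ a ∷ r → lastAdmits ws u ≡ b
lastAdmits-lastWord ws u last eq with initLast ws
lastAdmits-lastWord .[]         u last () | []
lastAdmits-lastWord .(ys ∷ʳ v)  u last eq | ys ∷ʳ′ v =
  trans (lastAdmits-∷ʳ ys v u) (last v (trans (sym (reverse-spelling-∷ʳ ys v)) eq))

lastWordTerm-admitted : ∀ u r w ws → weight u ≡ 1 → (reverse (spelling ws) ≡ r → lastAdmits ws u ≡ true) →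
                        lastWordTerm (reverse (spell u) ++ r) (suc w) ws u ≡ coef u * revTerm r w ws
lastWordTerm-admitted u r w ws weight≡1 admitted
  rewrite ==ˢ-++ˡ (reverse (spell u)) (reverse (spelling ws)) r | weight≡1
  = cong (coef u *_) (if-guarded (((reverse (spelling ws) ==ˢ r) ∧ adjOK ws) ∧ (weightP ws ≡ᵇ w))
                                 (λ match → admitted (==ˢ-sound _ r (∧-true-left (∧-true-left match)))))

lastWordTerm-blocked : ∀ u r w ws → (reverse (spelling ws) ≡ r → lastAdmits ws u ≡ false) →
                       lastWordTerm (reverse (spell u) ++ r) w ws u ≡ + 0
lastWordTerm-blocked u r w ws blocked
  rewrite ==ˢ-++ˡ (reverse (spell u)) (reverse (spelling ws)) r
  = trans (cong (coef u *_) (if-blocked (((reverse (spelling ws) ==ˢ r) ∧ adjOK ws) ∧ (weight u ℕ.+ weightP ws ≡ᵇ w))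
                                        (λ match → blocked (==ˢ-sound _ r (∧-true-left (∧-true-left match))))))
          (ℤP.*-zeroʳ (coef u))

lastWordTerm-weight0 : ∀ r ws u → weight u ≡ 1 → lastWordTerm r 0 ws u ≡ + 0
lastWordTerm-weight0 r ws u weight≡1 rewrite weight≡1
  | ∧-zeroʳ (((reverse (spell u) ++ reverse (spelling ws)) ==ˢ r) ∧ adjOK ws) = ℤP.*-zeroʳ (coef u)

lastWordTerm-weight0-A : ∀ r ws u → lastWordTerm (A ∷ r) 0 ws u ≡ + 0
lastWordTerm-weight0-A r ws wX = refl
lastWordTerm-weight0-A r ws wXA  = lastWordTerm-weight0 (A ∷ r) ws wXA refl
lastWordTerm-weight0-A r ws wXAA = lastWordTerm-weight0 (A ∷ r) ws wXAA refl
lastWordTerm-weight0-A r ws wAXA = lastWordTerm-weight0 (A ∷ r) ws wAXA refl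
lastWordTerm-weight0-A r ws wAAA = lastWordTerm-weight0 (A ∷ r) ws wAAA refl
lastWordTerm-weight0-A r ws wBA  = lastWordTerm-weight0 (A ∷ r) ws wBA refl
lastWordTerm-weight0-A r ws wABA = lastWordTerm-weight0 (A ∷ r) ws wABA refl
lastWordTerm-weight0-A r ws wXXA = lastWordTerm-weight0 (A ∷ r) ws wXXA refl

lastWordSum-weight0 : ∀ p a b ws → lastWordSum (p ++ a ∷ b ∷ A ∷ []) 0 ws ≡ + 0
lastWordSum-weight0 p a b ws =
  trans (lastWordSum-++ p _ 0 ws) (sumOf-zero (lastWordTerm-weight0-A (b ∷ a ∷ reverse p) ws) allWords)

lastWordSum-AAA : ∀ p w ws → lastWordSum (p ++ A ∷ A ∷ A ∷ []) (suc w) ws ≡ -[1+ 0 ] * term p w ws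
lastWordSum-AAA p w ws = begin
  lastWordSum (p ++ A ∷ A ∷ A ∷ []) (suc w) ws  ≡⟨ lastWordSum-++ p _ (suc w) ws ⟩
  sumOf ending allWords                         ≡⟨ only-AAA (ending wAAA) ⟩
  ending wAAA                                   ≡⟨ lastWordTerm-admitted wAAA r w ws refl (λ _ → lastAdmits-unforbidden ws wAAA refl) ⟩
  -[1+ 0 ] * revTerm r w ws                      ≡⟨ cong (-[1+ 0 ] *_) (term-reverse p w ws) ⟨
  -[1+ 0 ] * term p w ws                         ∎
  where
  r : List Letter
  r = reverse p
  ending : Word → ℤ
  ending = lastWordTerm (A ∷ A ∷ A ∷ r) (suc w) ws
  only-AAA : ∀ a → + 0 + (+ 0 + (+ 0 + (+ 0 + (a + (+ 0 + (+ 0 + (+ 0 + + 0))))))) ≡ a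
  only-AAA = solve-∀

lastWordSum-XAA : ∀ p w ws → lastWordSum (p ++ X ∷ A ∷ A ∷ []) (suc w) ws ≡ + 1 * term p w ws
lastWordSum-XAA p w ws = begin
  lastWordSum (p ++ X ∷ A ∷ A ∷ []) (suc w) ws  ≡⟨ lastWordSum-++ p _ (suc w) ws ⟩
  sumOf ending allWords                         ≡⟨ only-XAA (ending wXAA) ⟩
  ending wXAA                                   ≡⟨ lastWordTerm-admitted wXAA r w ws refl (λ _ → lastAdmits-unforbidden ws wXAA refl) ⟩
  + 1 * revTerm r w ws                           ≡⟨ cong (+ 1 *_) (term-reverse p w ws) ⟨
  + 1 * term p w ws                              ∎
  where
  r : List Letter
  r = reverse p
  ending : Word → ℤ
  ending = lastWordTerm (A ∷ A ∷ X ∷ r) (suc w) ws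
  only-XAA : ∀ a → + 0 + (+ 0 + (a + (+ 0 + (+ 0 + (+ 0 + (+ 0 + (+ 0 + + 0))))))) ≡ a
  only-XAA = solve-∀

lastWordSum-XXA : ∀ p w ws → lastWordSum (p ++ X ∷ X ∷ A ∷ []) (suc w) ws ≡ -[1+ 0 ] * term p w ws
lastWordSum-XXA p w ws = begin
  lastWordSum (p ++ X ∷ X ∷ A ∷ []) (suc w) ws  ≡⟨ lastWordSum-++ p _ (suc w) ws ⟩
  sumOf ending allWords                         ≡⟨ only-XA-XXA (ending wXA) (ending wXXA) ⟩
  ending wXA + ending wXXA                      ≡⟨ cong₂ _+_ XA-blocked XXA-admitted ⟩
  + 0 + -[1+ 0 ] * revTerm r w ws                ≡⟨ ℤP.+-identityˡ _ ⟩
  -[1+ 0 ] * revTerm r w ws                      ≡⟨ cong (-[1+ 0 ] *_) (term-reverse p w ws) ⟨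
  -[1+ 0 ] * term p w ws                         ∎
  where
  r : List Letter
  r = reverse p
  ending : Word → ℤ
  ending = lastWordTerm (A ∷ X ∷ X ∷ r) (suc w) ws
  only-XA-XXA : ∀ a b → + 0 + (a + (+ 0 + (+ 0 + (+ 0 + (+ 0 + (+ 0 + (b + + 0))))))) ≡ a + b
  only-XA-XXA = solve-∀
  XA-blocked : ending wXA ≡ + 0
  XA-blocked = lastWordTerm-blocked wXA (X ∷ r) (suc w) ws (lastAdmits-lastWord ws wXA (λ v → admits-XA-after-X v))
  XXA-admitted : ending wXXA ≡ -[1+ 0 ] * revTerm r w ws
  XXA-admitted = lastWordTerm-admitted wXXA r w ws refl (λ _ → lastAdmits-unforbidden ws wXXA refl)

lastWordSum-AXA : ∀ p w ws →
                  lastWordSum (p ++ A ∷ X ∷ A ∷ []) (suc w) ws ≡ + 1 * term (p ∷ʳ A) w ws + + 2 * term p w ws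
lastWordSum-AXA p w ws = begin
  lastWordSum (p ++ A ∷ X ∷ A ∷ []) (suc w) ws       ≡⟨ lastWordSum-++ p _ (suc w) ws ⟩
  sumOf ending allWords                              ≡⟨ only-XA-AXA (ending wXA) (ending wAXA) ⟩
  ending wXA + ending wAXA                           ≡⟨ cong₂ _+_ XA-admitted AXA-admitted ⟩
  + 1 * revTerm (A ∷ r) w ws + + 2 * revTerm r w ws   ≡⟨ cong₂ (λ x y → + 1 * x + + 2 * y) (term-reverse-∷ʳ p A w ws)
                                                                                           (term-reverse p w ws) ⟨
  + 1 * term (p ∷ʳ A) w ws + + 2 * term p w ws        ∎
  where
  r : List Letter
  r = reverse p
  ending : Word → ℤ
  ending = lastWordTerm (A ∷ X ∷ A ∷ r) (suc w) ws
  only-XA-AXA : ∀ a b → + 0 + (a + (+ 0 + (b + (+ 0 + (+ 0 + (+ 0 + (+ 0 + + 0))))))) ≡ a + b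
  only-XA-AXA = solve-∀
  XA-admitted : ending wXA ≡ + 1 * revTerm (A ∷ r) w ws
  XA-admitted = lastWordTerm-admitted wXA (A ∷ r) w ws refl (lastAdmits-lastWord ws wXA (λ v → admits-after-A v wXA))
  AXA-admitted : ending wAXA ≡ + 2 * revTerm r w ws
  AXA-admitted = lastWordTerm-admitted wAXA r w ws refl (λ _ → lastAdmits-unforbidden ws wAXA refl)

lastWordSum-ABA : ∀ p w ws →
                  lastWordSum (p ++ A ∷ B ∷ A ∷ []) (suc w) ws ≡ -[1+ 0 ] * term (p ∷ʳ A) w ws + -[1+ 0 ] * term p w ws
lastWordSum-ABA p w ws = begin
  lastWordSum (p ++ A ∷ B ∷ A ∷ []) (suc w) ws                 ≡⟨ lastWordSum-++ p _ (suc w) ws ⟩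
  sumOf ending allWords                                        ≡⟨ only-BA-ABA (ending wBA) (ending wABA) ⟩
  ending wBA + ending wABA                                     ≡⟨ cong₂ _+_ BA-admitted ABA-admitted ⟩
  -[1+ 0 ] * revTerm (A ∷ r) w ws + -[1+ 0 ] * revTerm r w ws   ≡⟨ cong₂ (λ x y → -[1+ 0 ] * x + -[1+ 0 ] * y)
                                                                         (term-reverse-∷ʳ p A w ws) (term-reverse p w ws) ⟨
  -[1+ 0 ] * term (p ∷ʳ A) w ws + -[1+ 0 ] * term p w ws        ∎
  where
  r : List Letter
  r = reverse p
  ending : Word → ℤ
  ending = lastWordTerm (A ∷ B ∷ A ∷ r) (suc w) ws
  only-BA-ABA : ∀ a b → + 0 + (+ 0 + (+ 0 + (+ 0 + (+ 0 + (a + (b + (+ 0 + + 0))))))) ≡ a + b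
  only-BA-ABA = solve-∀
  BA-admitted : ending wBA ≡ -[1+ 0 ] * revTerm (A ∷ r) w ws
  BA-admitted = lastWordTerm-admitted wBA (A ∷ r) w ws refl (lastAdmits-lastWord ws wBA (λ v → admits-after-A v wBA))
  ABA-admitted : ending wABA ≡ -[1+ 0 ] * revTerm r w ws
  ABA-admitted = lastWordTerm-admitted wABA r w ws refl (λ _ → lastAdmits-unforbidden ws wABA refl)

c-weight0 : ∀ W a b → c (W ++ a ∷ b ∷ A ∷ []) 0 ≡ + 0
c-weight0 W a b = c-vanishing W _ 0 (lastWordSum-weight0 (pad W) a b)

relation-AAA : ∀ W w → val (W ++ A ∷ A ∷ A ∷ []) w + t· (val W) w ≡ + 0
relation-AAA W zero    = cong (λ x → x + + 0) (c-weight0 W A A)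
relation-AAA W (suc w) =
  trans (cong (λ x → x + c W w) (c-recurrence₁ W _ -[1+ 0 ] W (length-<-++ (pad W)) (lastWordSum-AAA (pad W) w)))
        (cancel (c W w))
  where
  cancel : ∀ x → -[1+ 0 ] * x + x ≡ + 0
  cancel = solve-∀

relation-XAA : ∀ W w → val (W ++ X ∷ A ∷ A ∷ []) w - t· (val W) w ≡ + 0
relation-XAA W zero    = cong (λ x → x - + 0) (c-weight0 W X A)
relation-XAA W (suc w) =
  trans (cong (λ x → x - c W w) (c-recurrence₁ W _ (+ 1) W (length-<-++ (pad W)) (lastWordSum-XAA (pad W) w)))
        (cancel (c W w))
  where
  cancel : ∀ x → + 1 * x - x ≡ + 0
  cancel = solve-∀

relation-XXA : ∀ W w → val (W ++ X ∷ X ∷ A ∷ []) w + t· (val W) w ≡ + 0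
relation-XXA W zero    = cong (λ x → x + + 0) (c-weight0 W X X)
relation-XXA W (suc w) =
  trans (cong (λ x → x + c W w) (c-recurrence₁ W _ -[1+ 0 ] W (length-<-++ (pad W)) (lastWordSum-XXA (pad W) w)))
        (cancel (c W w))
  where
  cancel : ∀ x → -[1+ 0 ] * x + x ≡ + 0
  cancel = solve-∀

relation-AXA : ∀ W w → val (W ++ A ∷ X ∷ A ∷ []) w - t· (val (W ∷ʳ A)) w - + 2 * t· (val W) w ≡ + 0
relation-AXA W zero    = cong (λ x → x - + 0 - + 2 * + 0) (c-weight0 W A X)
relation-AXA W (suc w) =
  trans (cong (λ x → x - c (W ∷ʳ A) w - + 2 * c W w)
              (c-recurrence₂ W _ (+ 1) (+ 2) (W ∷ʳ A) W (length-∷ʳ-<-++ (pad W) A) (length-<-++ (pad W))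
                             (lastWordSum-AXA (pad W) w)))
        (cancel (c (W ∷ʳ A) w) (c W w))
  where
  cancel : ∀ x y → + 1 * x + + 2 * y - x - + 2 * y ≡ + 0
  cancel = solve-∀

relation-ABA : ∀ W w → val (W ++ A ∷ B ∷ A ∷ []) w + t· (val (W ∷ʳ A)) w + t· (val W) w ≡ + 0
relation-ABA W zero    = cong (λ x → x + + 0 + + 0) (c-weight0 W A B)
relation-ABA W (suc w) =
  trans (cong (λ x → x + c (W ∷ʳ A) w + c W w)
              (c-recurrence₂ W _ -[1+ 0 ] -[1+ 0 ] (W ∷ʳ A) W (length-∷ʳ-<-++ (pad W) A) (length-<-++ (pad W))
                             (lastWordSum-ABA (pad W) w)))
        (cancel (c (W ∷ʳ A) w) (c W w))
  where
  cancel : ∀ x y → -[1+ 0 ] * x + -[1+ 0 ] * y + x + y ≡ + 0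
  cancel = solve-∀

lemma4p4 : (W : List Letter) → (w : ℕ) →
    ((val (W ++ A ∷ A ∷ A ∷ [])) w + t· (val (W)) w ≡ + 0)
    × ((val (W ++ X ∷ A ∷ A ∷ [])) w - t· (val (W)) w ≡ + 0)
    × ((val (W ++ X ∷ X ∷ A ∷ [])) w + t· (val (W)) w ≡ + 0)
    × ((val (W ++ A ∷ X ∷ A ∷ [])) w - t· (val (W ++ A ∷ [])) w - + 2 * t· (val (W)) w ≡ + 0)
    × ((val (W ++ A ∷ B ∷ A ∷ [])) w + t· (val (W ++ A ∷ [])) w + t· (val (W)) w ≡ + 0)
lemma4p4 W w = relation-AAA W w , relation-XAA W w , relation-XXA W w , relation-AXA W w , relation-ABA W w
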